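{- Let $T$ be a tour in a complete graph. If two 2-changes on $T$ share exactly one tour-edge, then they are chord-disjoint.
   Context: A tour is a Hamiltonian cycle; its edges are tour-edges, the other edges chord-edges. A 2-change $S_T(e,f)$ on $T$, for two non-adjacent tour-edges $e,f$, removes $e,f$ and adds the unique two chord-edges that reconnect the result into a new tour. Two 2-changes share a tour-edge if that edge is removed by both. Two 2-changes are chord-disjoint if they add no common chord-edge. -}

module Defs where

open import Data.Nat using (ℕ; zero; suc; _≤_)
open import Data.Nat.DivMod using (_%_; m%n<n)
open import Data.Fin using (Fin; toℕ; fromℕ<)
open import Data.Product using (_×_; Σ; ∃; _,_)
open import Data.Sum using (_⊎_)
open import Data.Empty using (⊥)
open import Relation.Binary.PropositionalEquality using (_≡_)
open import Function.Definitions using (Injective)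

-- Vertices of the complete graph K_n are Fin n; every pair of distinct
-- vertices is an edge.
Edge : ℕ → Set
Edge n = Fin n × Fin n

_≈ᴱ_ : ∀ {n} → Edge n → Edge n → Set
(a , b) ≈ᴱ (c , d) = (a ≡ c × b ≡ d) ⊎ (a ≡ d × b ≡ c)

_∈ᴱ_ : ∀ {n} → Fin n → Edge n → Set
v ∈ᴱ (a , b) = v ≡ a ⊎ v ≡ b

next : ∀ {n} → Fin n → Fin n
next {suc m} i = fromℕ< (m%n<n (suc (toℕ i)) (suc m))

-- A tour (Hamiltonian cycle) in K_n: a cyclic ordering of all n vertices,
-- given by an injective (hence bijective) map σ from positions to vertices.
record Tour (n : ℕ) : Set where
  field
    σ     : Fin n → Fin n
    σ-inj : Injective _≡_ _≡_ σ

open Tour public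

tourEdge : ∀ {n} → Tour n → Fin n → Edge n
tourEdge T i = (σ T i , σ T (next i))

NonAdjacent : ∀ {n} → Edge n → Edge n → Set
NonAdjacent {n} e f = (v : Fin n) → v ∈ᴱ e → v ∈ᴱ f → ⊥

record TwoChange {n : ℕ} (T : Tour n) : Set where
  field
    i j    : Fin n
    nonadj : NonAdjacent (tourEdge T i) (tourEdge T j)

open TwoChange public

Removes : ∀ {n} {T : Tour n} → TwoChange T → Edge n → Set
Removes {T = T} c g = g ≈ᴱ tourEdge T (i c) ⊎ g ≈ᴱ tourEdge T (j c)

-- The unique two chord-edges that reconnect the tour after removing
-- e = {σ i, σ(i+1)} and f = {σ j, σ(j+1)}:  {σ i, σ j} and {σ(i+1), σ(j+1)}.
Adds : ∀ {n} {T : Tour n} → TwoChange T → Edge n → Set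
Adds {T = T} c g =
  g ≈ᴱ (σ T (i c) , σ T (j c)) ⊎ g ≈ᴱ (σ T (next (i c)) , σ T (next (j c)))

ShareExactlyOne : ∀ {n} {T : Tour n} → TwoChange T → TwoChange T → Set
ShareExactlyOne {n} c d =
  Σ (Edge n) λ g → Removes c g × Removes d g
    × ((g' : Edge n) → Removes c g' → Removes d g' → g' ≈ᴱ g)

ChordDisjoint : ∀ {n} {T : Tour n} → TwoChange T → TwoChange T → Set
ChordDisjoint {n} c d = (g : Edge n) → Adds c g → Adds d g → ⊥

-- A chord of a 2-change joins the first endpoints σ i, σ j of its two removed tour-edges,
-- or their second endpoints σ (i+1), σ (j+1).  If c and d add a common chord of the same
-- kind, then by injectivity of σ and of i ↦ i+1 they remove the same two tour-edges, so
-- sharing exactly one forces these two edges to coincide, contradicting non-adjacency.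
-- If the common chord is of different kinds, then {i_c, j_c} = {i_d + 1, j_d + 1}, and a
-- shared tour-edge puts one position both in {i_d, j_d} and in {i_d + 1, j_d + 1}, which
-- again contradicts non-adjacency (or i + 1 ≠ i).  Identifying a shared tour-edge with a
-- shared position needs i + 2 ≠ i, i.e. n ≥ 3.
module Submission where

open import Defs
open import Data.Nat using (ℕ; suc; _≤_; s≤s; _≟_)
open import Data.Nat.Properties using (suc-injective; 1+n≢n; n<1+n; m<n⇒m<1+n; <⇒≤; <⇒≢; ≤∧≢⇒<)
open import Data.Nat.DivMod using (_%_; m<n⇒m%n≡m; n%n≡0)
open import Data.Fin using (Fin; toℕ)
open import Data.Fin.Properties using (toℕ-fromℕ<; toℕ-injective; toℕ≤pred[n])
open import Data.Product using (_×_; ∃; _,_)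
open import Data.Sum using (inj₁; inj₂)
open import Data.Empty using (⊥; ⊥-elim)
open import Relation.Nullary using (¬_; yes; no)
open import Relation.Binary.PropositionalEquality using (_≡_; _≢_; refl; sym; trans; cong)
open Relation.Binary.PropositionalEquality.≡-Reasoning
open import Function using (_∘_)
open import Function.Definitions using (Injective)

module _ {n : ℕ} where

  ≈ᴱ-refl : {e : Edge n} → e ≈ᴱ e
  ≈ᴱ-refl = inj₁ (refl , refl)

  ≈ᴱ-sym : {e f : Edge n} → e ≈ᴱ f → f ≈ᴱ e
  ≈ᴱ-sym (inj₁ (refl , refl)) = ≈ᴱ-refl
  ≈ᴱ-sym (inj₂ (refl , refl)) = inj₂ (refl , refl)

  ≈ᴱ-trans : {e f g : Edge n} → e ≈ᴱ f → f ≈ᴱ g → e ≈ᴱ g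
  ≈ᴱ-trans (inj₁ (refl , refl)) q                    = q
  ≈ᴱ-trans (inj₂ (refl , refl)) (inj₁ (refl , refl)) = inj₂ (refl , refl)
  ≈ᴱ-trans (inj₂ (refl , refl)) (inj₂ (refl , refl)) = ≈ᴱ-refl

  ∈ᴱ-resp-≈ᴱ : {v : Fin n} {e f : Edge n} → v ∈ᴱ e → e ≈ᴱ f → v ∈ᴱ f
  ∈ᴱ-resp-≈ᴱ (inj₁ refl) (inj₁ (refl , refl)) = inj₁ refl
  ∈ᴱ-resp-≈ᴱ (inj₂ refl) (inj₁ (refl , refl)) = inj₂ refl
  ∈ᴱ-resp-≈ᴱ (inj₁ refl) (inj₂ (refl , refl)) = inj₂ refl
  ∈ᴱ-resp-≈ᴱ (inj₂ refl) (inj₂ (refl , refl)) = inj₁ refl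

  ∈ᴱ-map : ∀ {m} (f : Fin n → Fin m) {v a b : Fin n} → v ∈ᴱ (a , b) → f v ∈ᴱ (f a , f b)
  ∈ᴱ-map f (inj₁ refl) = inj₁ refl
  ∈ᴱ-map f (inj₂ refl) = inj₂ refl

  ≈ᴱ-reflect : ∀ {m} {f : Fin n → Fin m} → Injective _≡_ _≡_ f →
               {a b c d : Fin n} → (f a , f b) ≈ᴱ (f c , f d) → (a , b) ≈ᴱ (c , d)
  ≈ᴱ-reflect f-inj (inj₁ (p , q)) = inj₁ (f-inj p , f-inj q)
  ≈ᴱ-reflect f-inj (inj₂ (p , q)) = inj₂ (f-inj p , f-inj q)

nonAdjacent⇒≉ᴱ : ∀ {n} {e f : Edge n} → NonAdjacent e f → ¬ e ≈ᴱ f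
nonAdjacent⇒≉ᴱ {e = a , b} e∦f e≈f = e∦f a (inj₁ refl) (∈ᴱ-resp-≈ᴱ (inj₁ refl) e≈f)

data NextView {n : ℕ} (i : Fin n) : Set where
  step : toℕ (next i) ≡ suc (toℕ i) → NextView i
  wrap : toℕ (next i) ≡ 0 → suc (toℕ i) ≡ n → NextView i

nextView : ∀ {n} (i : Fin n) → NextView i
nextView {suc m} i with toℕ i ≟ m
... | yes i≡m = wrap (begin
  toℕ (next i)         ≡⟨ toℕ-fromℕ< _ ⟩
  suc (toℕ i) % suc m  ≡⟨ cong (λ k → suc k % suc m) i≡m ⟩
  suc m % suc m        ≡⟨ n%n≡0 (suc m) ⟩
  0                    ∎) (cong suc i≡m)
... | no i≢m = step (trans (toℕ-fromℕ< _) (m<n⇒m%n≡m (s≤s (≤∧≢⇒< (toℕ≤pred[n] i) i≢m))))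

next-injective : ∀ {n} → Injective _≡_ _≡_ (next {n})
next-injective {x = a} {b} eq with nextView a | nextView b
... | step p | step q = toℕ-injective (suc-injective (trans (sym p) (trans (cong toℕ eq) q)))
... | step p | wrap q _ with () ← trans (sym p) (trans (cong toℕ eq) q)
... | wrap p _ | step q with () ← trans (sym q) (trans (cong toℕ (sym eq)) p)
... | wrap _ p | wrap _ q = toℕ-injective (suc-injective (trans p (sym q)))

next-irreflexive : ∀ {n} → 2 ≤ n → (i : Fin n) → next i ≢ i
next-irreflexive 2≤n i eq with nextView i
... | step p   = 1+n≢n (trans (sym p) (cong toℕ eq))
... | wrap p q = <⇒≢ 2≤n (trans (cong suc (trans (sym p) (cong toℕ eq))) q)

next²-irreflexive : ∀ {n} → 3 ≤ n → (i : Fin n) → next (next i) ≢ i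
next²-irreflexive {n} 3≤n i eq with nextView i | nextView (next i)
... | step p | step q = <⇒≢ (m<n⇒m<1+n (n<1+n (toℕ i))) (begin
  toℕ i                      ≡⟨ cong toℕ eq ⟨
  toℕ (next (next i))        ≡⟨ q ⟩
  suc (toℕ (next i))         ≡⟨ cong suc p ⟩
  suc (suc (toℕ i))          ∎)
... | step p | wrap q r = <⇒≢ 3≤n (begin
  2                          ≡⟨ cong (suc ∘ suc) (trans (sym (cong toℕ eq)) q) ⟨
  suc (suc (toℕ i))          ≡⟨ cong suc p ⟨
  suc (toℕ (next i))         ≡⟨ r ⟩
  n                          ∎)
... | wrap p q | step r = <⇒≢ 3≤n (begin
  2                          ≡⟨ cong (suc ∘ suc) p ⟨
  suc (suc (toℕ (next i)))   ≡⟨ cong suc r ⟨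
  suc (toℕ (next (next i)))  ≡⟨ cong (suc ∘ toℕ) eq ⟩
  suc (toℕ i)                ≡⟨ q ⟩
  n                          ∎)
... | wrap p _ | wrap _ r = <⇒≢ (<⇒≤ 3≤n) (trans (cong suc (sym p)) r)

tourEdge-injective : ∀ {n} → 3 ≤ n → (T : Tour n) {a b : Fin n} →
                     tourEdge T a ≈ᴱ tourEdge T b → a ≡ b
tourEdge-injective 3≤n T (inj₁ (p , _)) = σ-inj T p
tourEdge-injective 3≤n T {b = b} (inj₂ (p , q)) with refl ← σ-inj T p =
  ⊥-elim (next²-irreflexive 3≤n b (σ-inj T q))

chord-positions : ∀ {n} (T : Tour n) {h : Edge n} {a b a′ b′ : Fin n} →
                  h ≈ᴱ (σ T a , σ T b) → h ≈ᴱ (σ T a′ , σ T b′) → (a , b) ≈ᴱ (a′ , b′)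
chord-positions T p q = ≈ᴱ-reflect (σ-inj T) (≈ᴱ-trans (≈ᴱ-sym p) q)

module _ {n : ℕ} {T : Tour n} where

  removes-tourEdge : (c : TwoChange T) {k : Fin n} → k ∈ᴱ (i c , j c) → Removes c (tourEdge T k)
  removes-tourEdge c (inj₁ refl) = inj₁ ≈ᴱ-refl
  removes-tourEdge c (inj₂ refl) = inj₂ ≈ᴱ-refl

  removed-position : (c : TwoChange T) {g : Edge n} → Removes c g →
                     ∃ λ k → k ∈ᴱ (i c , j c) × g ≈ᴱ tourEdge T k
  removed-position c (inj₁ g≈) = i c , inj₁ refl , g≈
  removed-position c (inj₂ g≈) = j c , inj₂ refl , g≈

  shared-position : 3 ≤ n → (c d : TwoChange T) {g : Edge n} → Removes c g → Removes d g →
                    ∃ λ k → k ∈ᴱ (i c , j c) × k ∈ᴱ (i d , j d)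
  shared-position 3≤n c d c-g d-g
    with k , k∈c , g≈k ← removed-position c c-g | l , l∈d , g≈l ← removed-position d d-g
    with refl ← tourEdge-injective 3≤n T (≈ᴱ-trans (≈ᴱ-sym g≈k) g≈l) = k , k∈c , l∈d

  nonadj-positions : (c : TwoChange T) {k : Fin n} →
                     k ∈ᴱ (i c , next (i c)) → k ∈ᴱ (j c , next (j c)) → ⊥
  nonadj-positions c k∈e k∈f = nonadj c _ (∈ᴱ-map (σ T) k∈e) (∈ᴱ-map (σ T) k∈f)

  removed∉next : 2 ≤ n → (c : TwoChange T) {k : Fin n} →
                 k ∈ᴱ (i c , j c) → k ∈ᴱ (next (i c) , next (j c)) → ⊥
  removed∉next 2≤n c (inj₁ refl) (inj₁ p) = next-irreflexive 2≤n (i c) (sym p)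
  removed∉next 2≤n c (inj₁ refl) (inj₂ p) = nonadj-positions c (inj₁ refl) (inj₂ p)
  removed∉next 2≤n c (inj₂ refl) (inj₁ p) = nonadj-positions c (inj₂ p) (inj₁ refl)
  removed∉next 2≤n c (inj₂ refl) (inj₂ p) = next-irreflexive 2≤n (j c) (sym p)

  sameRemoved⇒¬shareExactlyOne : (c d : TwoChange T) →
                                 (i c , j c) ≈ᴱ (i d , j d) → ¬ ShareExactlyOne c d
  sameRemoved⇒¬shareExactlyOne c d c≈d (g , _ , _ , unique) =
    nonAdjacent⇒≉ᴱ (nonadj c) (≈ᴱ-trans (≈g (inj₁ refl)) (≈ᴱ-sym (≈g (inj₂ refl))))
    where
    ≈g : {k : Fin n} → k ∈ᴱ (i c , j c) → tourEdge T k ≈ᴱ g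
    ≈g k∈c = unique _ (removes-tourEdge c k∈c) (removes-tourEdge d (∈ᴱ-resp-≈ᴱ k∈c c≈d))

  shiftedRemoved⇒¬shareEdge : 3 ≤ n → (c d : TwoChange T) →
                              (i c , j c) ≈ᴱ (next (i d) , next (j d)) →
                              {g : Edge n} → Removes c g → Removes d g → ⊥
  shiftedRemoved⇒¬shareEdge 3≤n c d c≈d⁺ c-g d-g
    with k , k∈c , k∈d ← shared-position 3≤n c d c-g d-g =
    removed∉next (<⇒≤ 3≤n) d k∈d (∈ᴱ-resp-≈ᴱ k∈c c≈d⁺)

lemma8 : (n : ℕ) → 3 ≤ n → (T : Tour n) → (c d : TwoChange T) →
           ShareExactlyOne c d → ChordDisjoint c d
lemma8 n 3≤n T c d share h (inj₁ p) (inj₁ q) =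
  sameRemoved⇒¬shareExactlyOne c d (chord-positions T p q) share
lemma8 n 3≤n T c d share h (inj₂ p) (inj₂ q) =
  sameRemoved⇒¬shareExactlyOne c d (≈ᴱ-reflect next-injective (chord-positions T p q)) share
lemma8 n 3≤n T c d (_ , c-g , d-g , _) h (inj₁ p) (inj₂ q) =
  shiftedRemoved⇒¬shareEdge 3≤n c d (chord-positions T p q) c-g d-g
lemma8 n 3≤n T c d (_ , c-g , d-g , _) h (inj₂ p) (inj₁ q) =
  shiftedRemoved⇒¬shareEdge 3≤n d c (chord-positions T q p) d-g c-g
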